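{- Let $u_1,\ldots,u_m$ be positive integers and suppose there exist an orthogonal design $A=OD(n_1;\ u_1,\ldots,u_m)$ and an orthogonal design $B=OD(n_2;\ u_1,\ldots,u_m)$. Let $h=\gcd(n_1,n_2)$. Then there is an integer $N$ such that for each integer $t\ge N$ there exists an $OD(ht;\ u_1,\ldots,u_m)$. Moreover, if $A$ and $B$ are symmetric, then there is an integer $N$ such that for each $t\ge N$ there exists a symmetric $OD(ht;\ u_1,\ldots,u_m)$.
   Context: An orthogonal design $OD(n;\ s_1,\ldots,s_\ell)$ of order $n$ and type $(s_1,\ldots,s_\ell)$ is a square matrix $X$ of order $n$ with entries from $\{0,\pm x_1,\ldots,\pm x_\ell\}$, where the $x_j$ are commuting variables, satisfying $XX^{\rm T}=\big(\sum_{j=1}^\ell s_jx_j^2\big)I_n$. It is symmetric if $X^{\rm T}=X$. -}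

module Defs where

open import Data.Nat using (ℕ)
open import Data.Fin using (Fin)
open import Data.Integer using (ℤ; +_; -_; _+_; _*_; 0ℤ)
open import Data.Product using (Σ; _×_)
open import Relation.Binary.PropositionalEquality using (_≡_)

data Entry (ℓ : ℕ) : Set where
  zer : Entry ℓ
  pos : Fin ℓ → Entry ℓ
  neg : Fin ℓ → Entry ℓ

Design : ℕ → ℕ → Set
Design ℓ n = Fin n → Fin n → Entry ℓ

eval : {ℓ : ℕ} → (Fin ℓ → ℤ) → Entry ℓ → ℤ
eval x zer     = 0ℤ
eval x (pos j) = x j
eval x (neg j) = - x j

Σℤ : (n : ℕ) → (Fin n → ℤ) → ℤ
Σℤ ℕ.zero    f = 0ℤ
Σℤ (ℕ.suc n) f = f Fin.zero + Σℤ n (λ i → f (Fin.suc i))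

quad : {ℓ : ℕ} → (Fin ℓ → ℕ) → (Fin ℓ → ℤ) → ℤ
quad {ℓ} s x = Σℤ ℓ (λ j → (+ s j) * (x j * x j))

-- X Xᵀ = (Σ_j s_j x_j²) I_n as a polynomial identity in the commuting
-- variables x_j; over ℤ (infinite integral domain) this is equivalent to the
-- identity holding for every integer assignment of the variables.
IsOD : {ℓ n : ℕ} → (Fin ℓ → ℕ) → Design ℓ n → Set
IsOD {ℓ} {n} s X =
  (x : Fin ℓ → ℤ) →
    ((i : Fin n) → Σℤ n (λ c → eval x (X i c) * eval x (X i c)) ≡ quad s x)
  × ((i k : Fin n) → ¬≡ i k → Σℤ n (λ c → eval x (X i c) * eval x (X k c)) ≡ 0ℤ)
  where
    open import Relation.Nullary using (¬_)
    ¬≡ : Fin n → Fin n → Set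
    ¬≡ i k = ¬ (i ≡ k)

ODExists : {ℓ : ℕ} → ℕ → (Fin ℓ → ℕ) → Set
ODExists {ℓ} n s = Σ (Design ℓ n) (λ X → IsOD s X)

Symmetric : {ℓ n : ℕ} → Design ℓ n → Set
Symmetric {ℓ} {n} X = (i k : Fin n) → X i k ≡ X k i

SymODExists : {ℓ : ℕ} → ℕ → (Fin ℓ → ℕ) → Set
SymODExists {ℓ} n s = Σ (Design ℓ n) (λ X → IsOD s X × Symmetric X)

{-# OPTIONS --safe #-}
module Submission where

-- Placing two orthogonal designs of the same type block-diagonally gives one of the
-- sum of their orders, symmetric if both are; with the empty design of order 0, the
-- orders of (symmetric) designs of type u thus form an additive submonoid of ℕ. It
-- contains n₁ and n₂, hence every large multiple of h = gcd n₁ n₂: from Bézout,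
-- h + y n₂ = x n₁, and writing t = r + q n₂ with r < n₂ we get
-- h t = r x n₁ + (h q − r y) n₂, whose coefficients are natural once q ≥ n₂ y.

open import Defs
open import Data.Nat using (ℕ; _*_; _≤_; _<_)
open import Data.Nat.GCD using (gcd)
open import Data.Fin using (Fin)
open import Data.Product using (Σ; _×_)

open import Data.Nat.Base using (zero; suc; _+_; _∸_; NonZero; >-nonZero; ≢-nonZero; ≢-nonZero⁻¹)
open import Data.Nat.Properties using (+-comm; *-assoc; ≤-trans; m≤n*m; m+[n∸m]≡n; *-monoˡ-≤; <⇒≤)
open import Data.Nat.DivMod using (_/_; _%_; m≡m%n+[m/n]*n; m%n<n; m*n/n≡m; /-monoˡ-≤)
open import Data.Nat.GCD using (module Bézout; gcd-GCD; gcd[m,n]≢0)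
open import Data.Nat.Tactic.RingSolver using (solve)
open import Data.List.Base using (_∷_; [])
open import Data.Fin.Base using (splitAt; join)
open import Data.Fin.Properties using (join-splitAt)
open import Data.Integer.Base using (ℤ; 0ℤ) renaming (_+_ to _+ℤ_; _*_ to _*ℤ_)
open import Data.Integer.Properties using (+-identityˡ; +-identityʳ; +-assoc; *-zeroˡ; *-zeroʳ)
open import Data.Product using (∃₂; _,_; proj₁; proj₂; map₂)
open import Data.Sum.Base using (_⊎_; inj₁; inj₂; map₁)
open import Relation.Binary.PropositionalEquality using (_≡_; refl; sym; trans; cong; cong₂; subst; module ≡-Reasoning)
open import Relation.Nullary using (¬_)

Eventually : (ℕ → Set) → Set
Eventually Q = Σ ℕ (λ N → (t : ℕ) → N ≤ t → Q t)

IsCombinationOf : ℕ → ℕ → ℕ → Set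
IsCombinationOf n₁ n₂ m = ∃₂ λ a b → m ≡ a * n₁ + b * n₂

combination-from-Bézout : ∀ {h n₁ n₂ x y r q c} →
  h + y * n₂ ≡ x * n₁ → r * y + c ≡ h * q → h * (r + q * n₂) ≡ (r * x) * n₁ + c * n₂
combination-from-Bézout {h} {n₁} {n₂} {x} {y} {r} {q} {c} bézout split = begin
  h * (r + q * n₂)                 ≡⟨ solve (h ∷ r ∷ q ∷ n₂ ∷ []) ⟩
  h * r + (h * q) * n₂             ≡⟨ cong (λ z → h * r + z * n₂) (sym split) ⟩
  h * r + (r * y + c) * n₂         ≡⟨ solve (h ∷ r ∷ y ∷ c ∷ n₂ ∷ []) ⟩
  r * (h + y * n₂) + c * n₂        ≡⟨ cong (λ z → r * z + c * n₂) bézout ⟩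
  r * (x * n₁) + c * n₂            ≡⟨ cong (_+ c * n₂) (sym (*-assoc r x n₁)) ⟩
  (r * x) * n₁ + c * n₂            ∎
  where open ≡-Reasoning

large-multiples-are-combinations : ∀ {h n₁ n₂} .{{_ : NonZero h}} .{{_ : NonZero n₂}} x y →
  h + y * n₂ ≡ x * n₁ → Eventually (λ t → IsCombinationOf n₁ n₂ (h * t))
large-multiples-are-combinations {h} {n₁} {n₂} x y bézout = n₂ * y * n₂ , combination
  where
  combination : ∀ t → n₂ * y * n₂ ≤ t → IsCombinationOf n₁ n₂ (h * t)
  combination t t≥N = r * x , h * q ∸ r * y , trans (cong (h *_) (m≡m%n+[m/n]*n t n₂))
    (combination-from-Bézout {h} {n₁} {n₂} {x} {y} {r} {q} bézout (m+[n∸m]≡n ry≤hq))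
    where
    r = t % n₂
    q = t / n₂
    q≥n₂y : n₂ * y ≤ q
    q≥n₂y = subst (_≤ q) (m*n/n≡m (n₂ * y) n₂) (/-monoˡ-≤ n₂ t≥N)
    ry≤hq : r * y ≤ h * q
    ry≤hq = ≤-trans (*-monoˡ-≤ y (<⇒≤ (m%n<n t n₂))) (≤-trans q≥n₂y (m≤n*m q h))

large-multiples-of-gcd-are-combinations : ∀ n₁ n₂ .{{_ : NonZero n₁}} .{{_ : NonZero n₂}} →
  Eventually (λ t → IsCombinationOf n₁ n₂ (gcd n₁ n₂ * t))
large-multiples-of-gcd-are-combinations n₁ n₂ = fromBézout (Bézout.identity (gcd-GCD n₁ n₂))
  where
  instance _ = ≢-nonZero (gcd[m,n]≢0 n₁ n₂ (inj₁ (≢-nonZero⁻¹ n₁)))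
  swap : ∀ {m} → IsCombinationOf n₂ n₁ m → IsCombinationOf n₁ n₂ m
  swap (a , b , m≡) = b , a , trans m≡ (+-comm (a * n₂) (b * n₁))
  fromBézout : Bézout.Identity (gcd n₁ n₂) n₁ n₂ → Eventually (λ t → IsCombinationOf n₁ n₂ (gcd n₁ n₂ * t))
  fromBézout (Bézout.+- x y bézout) = large-multiples-are-combinations {gcd n₁ n₂} x y bézout
  fromBézout (Bézout.-+ x y bézout) =
    map₂ (λ combination t t≥N → swap (combination t t≥N))
         (large-multiples-are-combinations {gcd n₁ n₂} y x bézout)

module AdditivelyClosed (P : ℕ → Set) (P-0 : P 0) (P-+ : ∀ {a b} → P a → P b → P (a + b)) where

  *-closed : ∀ k {a} → P a → P (k * a)
  *-closed zero    Pa = P-0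
  *-closed (suc k) Pa = P-+ Pa (*-closed k Pa)

  combination-closed : ∀ {n₁ n₂ m} → P n₁ → P n₂ → IsCombinationOf n₁ n₂ m → P m
  combination-closed Pn₁ Pn₂ (a , b , refl) = P-+ (*-closed a Pn₁) (*-closed b Pn₂)

  eventually-gcd-multiples : ∀ {n₁ n₂} .{{_ : NonZero n₁}} .{{_ : NonZero n₂}} →
    P n₁ → P n₂ → Eventually (λ t → P (gcd n₁ n₂ * t))
  eventually-gcd-multiples {n₁} {n₂} Pn₁ Pn₂ =
    map₂ (λ combination t t≥N → combination-closed Pn₁ Pn₂ (combination t t≥N))
         (large-multiples-of-gcd-are-combinations n₁ n₂)

Σℤ-zero : ∀ n {f : Fin n → ℤ} → (∀ i → f i ≡ 0ℤ) → Σℤ n f ≡ 0ℤ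
Σℤ-zero zero    f≡0 = refl
Σℤ-zero (suc n) f≡0 = cong₂ _+ℤ_ (f≡0 Fin.zero) (Σℤ-zero n (λ i → f≡0 (Fin.suc i)))

Σℤ-splitAt : ∀ a b (g : Fin a ⊎ Fin b → ℤ) →
  Σℤ (a + b) (λ i → g (splitAt a i)) ≡ Σℤ a (λ i → g (inj₁ i)) +ℤ Σℤ b (λ i → g (inj₂ i))
Σℤ-splitAt zero    b g = sym (+-identityˡ _)
Σℤ-splitAt (suc a) b g = trans
  (cong (g (inj₁ Fin.zero) +ℤ_) (Σℤ-splitAt a b (λ s → g (map₁ Fin.suc s))))
  (sym (+-assoc (g (inj₁ Fin.zero)) _ _))

splitAt-injective : ∀ a {b} {i k : Fin (a + b)} → splitAt a i ≡ splitAt a k → i ≡ k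
splitAt-injective a {b} {i} {k} eq =
  trans (sym (join-splitAt a b i)) (trans (cong (join a b) eq) (join-splitAt a b k))

rowProduct : ∀ {ℓ n} → (Fin ℓ → ℤ) → (Fin n → Entry ℓ) → (Fin n → Entry ℓ) → ℤ
rowProduct {n = n} x r s = Σℤ n (λ c → eval x (r c) *ℤ eval x (s c))

blockDiagonal : ∀ {ℓ a b} → Design ℓ a → Design ℓ b → Fin a ⊎ Fin b → Fin a ⊎ Fin b → Entry ℓ
blockDiagonal X Y (inj₁ i) (inj₁ k) = X i k
blockDiagonal X Y (inj₂ i) (inj₂ k) = Y i k
blockDiagonal X Y (inj₁ i) (inj₂ k) = zer
blockDiagonal X Y (inj₂ i) (inj₁ k) = zer

_⊕_ : ∀ {ℓ a b} → Design ℓ a → Design ℓ b → Design ℓ (a + b)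
_⊕_ {a = a} X Y i k = blockDiagonal X Y (splitAt a i) (splitAt a k)

module DirectSum {ℓ a b : ℕ} (X : Design ℓ a) (Y : Design ℓ b) where

  private
    block = blockDiagonal X Y

  blockProduct : (Fin ℓ → ℤ) → Fin a ⊎ Fin b → Fin a ⊎ Fin b → ℤ
  blockProduct x (inj₁ i) (inj₁ k) = rowProduct x (X i) (X k)
  blockProduct x (inj₂ i) (inj₂ k) = rowProduct x (Y i) (Y k)
  blockProduct x (inj₁ i) (inj₂ k) = 0ℤ
  blockProduct x (inj₂ i) (inj₁ k) = 0ℤ

  rowProduct-⊕ : ∀ x i k → rowProduct x ((X ⊕ Y) i) ((X ⊕ Y) k) ≡ blockProduct x (splitAt a i) (splitAt a k)
  rowProduct-⊕ x i k = trans (Σℤ-splitAt a b (λ r → E (block p r) *ℤ E (block q r))) (halves p q)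
    where
    E = eval x
    p = splitAt a i
    q = splitAt a k
    halves : ∀ p q → Σℤ a (λ c → E (block p (inj₁ c)) *ℤ E (block q (inj₁ c)))
                     +ℤ Σℤ b (λ c → E (block p (inj₂ c)) *ℤ E (block q (inj₂ c)))
                   ≡ blockProduct x p q
    halves (inj₁ i) (inj₁ k) =
      trans (cong (rowProduct x (X i) (X k) +ℤ_) (Σℤ-zero b (λ _ → refl))) (+-identityʳ _)
    halves (inj₂ i) (inj₂ k) =
      trans (cong (_+ℤ rowProduct x (Y i) (Y k)) (Σℤ-zero a (λ _ → refl))) (+-identityˡ _)
    halves (inj₁ i) (inj₂ k) =
      cong₂ _+ℤ_ (Σℤ-zero a (λ c → *-zeroʳ (E (X i c)))) (Σℤ-zero b (λ c → *-zeroˡ (E (Y k c))))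
    halves (inj₂ i) (inj₁ k) =
      cong₂ _+ℤ_ (Σℤ-zero a (λ c → *-zeroˡ (E (X k c)))) (Σℤ-zero b (λ c → *-zeroʳ (E (Y i c))))

  ⊕-isOD : ∀ {s} → IsOD s X → IsOD s Y → IsOD s (X ⊕ Y)
  ⊕-isOD {s} odX odY x =
    (λ i → trans (rowProduct-⊕ x i i) (diagonal (splitAt a i))) ,
    (λ i k i≢k → trans (rowProduct-⊕ x i k)
                       (offDiagonal (splitAt a i) (splitAt a k) (λ eq → i≢k (splitAt-injective a eq))))
    where
    diagonal : ∀ p → blockProduct x p p ≡ quad s x
    diagonal (inj₁ i) = proj₁ (odX x) i
    diagonal (inj₂ i) = proj₁ (odY x) i
    offDiagonal : ∀ p q → ¬ p ≡ q → blockProduct x p q ≡ 0ℤ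
    offDiagonal (inj₁ i) (inj₁ k) p≢q = proj₂ (odX x) i k (λ eq → p≢q (cong inj₁ eq))
    offDiagonal (inj₂ i) (inj₂ k) p≢q = proj₂ (odY x) i k (λ eq → p≢q (cong inj₂ eq))
    offDiagonal (inj₁ i) (inj₂ k) _   = refl
    offDiagonal (inj₂ i) (inj₁ k) _   = refl

  ⊕-symmetric : Symmetric X → Symmetric Y → Symmetric (X ⊕ Y)
  ⊕-symmetric symX symY i k = block-symmetric (splitAt a i) (splitAt a k)
    where
    block-symmetric : ∀ p q → block p q ≡ block q p
    block-symmetric (inj₁ i) (inj₁ k) = symX i k
    block-symmetric (inj₂ i) (inj₂ k) = symY i k
    block-symmetric (inj₁ i) (inj₂ k) = refl
    block-symmetric (inj₂ i) (inj₁ k) = refl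

open DirectSum using (⊕-isOD; ⊕-symmetric)

module _ {ℓ : ℕ} (s : Fin ℓ → ℕ) where

  ODExists-0 : ODExists 0 s
  ODExists-0 = (λ ()) , λ x → (λ ()) , (λ ())

  ODExists-+ : ∀ {a b} → ODExists a s → ODExists b s → ODExists (a + b) s
  ODExists-+ (X , odX) (Y , odY) = X ⊕ Y , ⊕-isOD X Y {s} odX odY

  SymODExists-0 : SymODExists 0 s
  SymODExists-0 = (λ ()) , proj₂ ODExists-0 , (λ ())

  SymODExists-+ : ∀ {a b} → SymODExists a s → SymODExists b s → SymODExists (a + b) s
  SymODExists-+ (X , odX , symX) (Y , odY , symY) =
    X ⊕ Y , ⊕-isOD X Y {s} odX odY , ⊕-symmetric X Y symX symY

lemma3p3 : (m : ℕ) (u : Fin m → ℕ) (n₁ n₂ : ℕ) →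
    ((i : Fin m) → 0 < u i) → 0 < n₁ → 0 < n₂ →
    ((ODExists n₁ u → ODExists n₂ u →
        Σ ℕ (λ N → (t : ℕ) → N ≤ t → ODExists (gcd n₁ n₂ * t) u))
    × (SymODExists n₁ u → SymODExists n₂ u →
        Σ ℕ (λ N → (t : ℕ) → N ≤ t → SymODExists (gcd n₁ n₂ * t) u)))
lemma3p3 _ u n₁ n₂ _ n₁>0 n₂>0 =
  AdditivelyClosed.eventually-gcd-multiples (λ n → ODExists n u) (ODExists-0 u) (ODExists-+ u) ,
  AdditivelyClosed.eventually-gcd-multiples (λ n → SymODExists n u) (SymODExists-0 u) (SymODExists-+ u)
  where
  instance
    _ = >-nonZero n₁>0
    _ = >-nonZero n₂>0
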